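{- For every context $\Gamma$, query $Q$, schema $\tau$ and evaluation $S$, if $[\![\Gamma\vdash Q:\tau]\!]^{\mathsf{3VL}}\Downarrow S$, then there exists $S'$ such that $[\![\Gamma\vdash Q^{\mathbf{tt}}:\tau]\!]^{\mathsf{2VL}}\Downarrow S'$ and $S\,\eta = S'\,\eta$ for every environment $\eta$ for $\Gamma$.
   Context: Syntax. Values are constants $\mathbf{k}$ or $\mathtt{NULL}$. A schema is a finite list of names; a context $\Gamma$ is a finite list of schemas, $\Gamma(n)$ its $n$-th element (0-based). Terms: $t::=n.x\mid\mathbf{k}\mid\mathtt{NULL}$. Queries: $\mathtt{SELECT}~[\mathtt{DISTINCT}]~\vec{t{:}x}~\mathtt{FROM}~T_1{:}\sigma_1,\dots,T_l{:}\sigma_l~\mathtt{WHERE}~c$, $\mathtt{SELECT}~[\mathtt{DISTINCT}]~\ast~\mathtt{FROM}~\vec{T{:}\sigma}~\mathtt{WHERE}~c$, $Q_1~op~[\mathtt{ALL}]~Q_2$ with $op\in\{\mathtt{UNION},\mathtt{INTERSECT},\mathtt{EXCEPT}\}$. Conditions: $\mathtt{TRUE},\mathtt{FALSE}, t~\mathtt{IS}~[\mathtt{NOT}]~\mathtt{NULL}, \vec t~[\mathtt{NOT}]~\mathtt{IN}~Q, P^n(t_1,\dots,t_n)$ ($P^n$ any function from $n$-lists of constants to booleans; $t=t'$ denotes the equality predicate), $\mathtt{EXISTS}~Q$, AND, OR, NOT. Tables: $\mathit{table}~x$ or $\mathit{query}~Q$. A database assigns to some names $x$ a schema $D(x)$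 and a finite multiset $D_{rel}(x)$ of $|D(x)|$-tuples of values. Translation $(\cdot)^{\mathbf{tt}}$ on queries, tables, conditions, mutually with $(\cdot)^{\mathbf{ff}}$ on conditions. Queries: $(\mathtt{SELECT}~[\mathtt{DISTINCT}]~\vec{t{:}x}~\mathtt{FROM}~\vec{T{:}\sigma}~\mathtt{WHERE}~c)^{\mathbf{tt}} = \mathtt{SELECT}~[\mathtt{DISTINCT}]~\vec{t{:}x}~\mathtt{FROM}~\vec{T^{\mathbf{tt}}{:}\sigma}~\mathtt{WHERE}~c^{\mathbf{tt}}$, similarly for $\mathtt{SELECT}~\ast$; set operations commute with $(\cdot)^{\mathbf{tt}}$ (keeping ALL). Tables: $(\mathit{table}~x)^{\mathbf{tt}}=\mathit{table}~x$, $(\mathit{query}~Q)^{\mathbf{tt}}=\mathit{query}~Q^{\mathbf{tt}}$. Conditions: $\mathtt{TRUE},\mathtt{FALSE}$, $t~\mathtt{IS}~[\mathtt{NOT}]~\mathtt{NULL}$, $P^n(\vec t)$ are unchanged by $\mathbf{tt}$; $(\mathtt{EXISTS}~Q)^{\mathbf{tt}}=\mathtt{EXISTS}~Q^{\mathbf{tt}}$; AND/OR commute with $\mathbf{tt}$; $(\mathtt{NOT}~c)^{\mathbf{tt}}=c^{\mathbf{ff}}$. $\mathtt{TRUE}^{\mathbf{ff}}=\mathtt{FALSE}$, $\mathtt{FALSE}^{\mathbf{ff}}=\mathtt{TRUE}$, $(t~\mathtt{IS}~\mathtt{NULL})^{\mathbf{ff}}=t~\mathtt{IS}~\mathtt{NOT}~\mathtt{NULL}$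 and vice versa, $P^n(\vec t)^{\mathbf{ff}}=\mathtt{NOT}~P^n(\vec t)~\mathtt{AND}~(t_1~\mathtt{IS}~\mathtt{NOT}~\mathtt{NULL}~\mathtt{AND}(\dots\mathtt{AND}(t_n~\mathtt{IS}~\mathtt{NOT}~\mathtt{NULL}~\mathtt{AND}~\mathtt{TRUE})))$, $(\mathtt{EXISTS}~Q)^{\mathbf{ff}}=\mathtt{NOT}~\mathtt{EXISTS}~Q^{\mathbf{tt}}$, $(c_1~\mathtt{AND}~c_2)^{\mathbf{ff}}=c_1^{\mathbf{ff}}~\mathtt{OR}~c_2^{\mathbf{ff}}$, $(c_1~\mathtt{OR}~c_2)^{\mathbf{ff}}=c_1^{\mathbf{ff}}~\mathtt{AND}~c_2^{\mathbf{ff}}$, $(\mathtt{NOT}~c)^{\mathbf{ff}}=c^{\mathbf{tt}}$. Membership: $(\vec t~\mathtt{IN}~Q)^{\mathbf{tt}}=(\vec t~\mathtt{NOT}~\mathtt{IN}~Q)^{\mathbf{ff}}=\vec t~\mathtt{IN}~Q^{\mathbf{tt}}$, and $(\vec t~\mathtt{NOT}~\mathtt{IN}~Q)^{\mathbf{tt}}=(\vec t~\mathtt{IN}~Q)^{\mathbf{ff}}=\mathtt{NOT}~\mathtt{EXISTS}~(\mathtt{SELECT}~\ast~\mathtt{FROM}~\mathit{query}~Q^{\mathbf{tt}}{:}(a_1,\dots,a_m)~\mathtt{WHERE}~C_1~\mathtt{AND}(\dots\mathtt{AND}(C_m~\mathtt{AND}~\mathtt{TRUE})))$, where $m=|\vec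 t|$, $a_1,\dots,a_m$ are pairwise distinct fresh names, $C_i = 0.a_i~\mathtt{IS}~\mathtt{NULL}~\mathtt{OR}~(t_i^+~\mathtt{IS}~\mathtt{NULL}~\mathtt{OR}~t_i^+=0.a_i)$, and $t^+$ increments the de Bruijn index of an attribute term by $1$ ($(n.x)^+=(n{+}1).x$, constants and NULL unchanged). Relations and environments: relations are finite multisets of tuples with $\oplus$ (sum of multiplicities), $\cap$ (min), $\setminus$ (truncated difference), $\times$ (product), $\sigma_p$ (filter), $\sum_{v\leftarrow r}f(v)$ (comprehension), $\|\cdot\|$ (deduplication), $\mathtt{card}$ (total multiplicity). An environment for $\Gamma=\sigma_1,\dots,\sigma_k$ is a list of value lists of lengths $|\sigma_i|$; $[\Gamma'\mapsto v]$ splits a tuple into an environment for $\Gamma'$; $\mathbin{++}$ concatenates environments. Truth values: $\mathsf{3VL}$ uses Kleene logic (btrue, bfalse, bmaybe $=$ ttrue, tfalse, unknown); $\mathsf{2VL}$ uses Booleans with btrue $=$ true and bfalse $=$ bmaybe $=$ false. $\mathrm{of\_bool}$, $\mathrm{is\_btrue}$, $\mathrm{is\_bfalse}$ as usual; $\mathrm{veq}(v,w)=$ bmaybe if $v$ or $w$ is NULL, else $\mathrm{of\_bool}(v=w)$. Semantics $[\![\cdot]\!]^{\mathbf{B}}\Downarrow$ (inductive relation). Terms: $n.x$ in $\Gamma$ evaluates (only if $x$ occurs exactly once in $\Gamma(n)$) to the corresponding entry of the $n$-th list of the environment; constants/NULL to themselves; term lists componentwise. Tables: $\mathit{table}~x$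 to $D_{rel}(x)$ with schema $D(x)$; $\mathit{query}~Q$ as $Q$. FROM lists $T_1{:}\rho_1,\dots,T_l{:}\rho_l$ (each $T_i$ evaluating with a schema of length $|\rho_i|$) evaluate to context $\Gamma'=\rho_1,\dots,\rho_l$ and the product of the $T_i$'s evaluations (the singleton empty tuple if $l=0$). $\mathtt{SELECT}~[\mathtt{DISTINCT}]~\vec{t{:}x}~\mathtt{FROM}\dots\mathtt{WHERE}~c$ has schema $\vec x$ and evaluates to $\eta\mapsto\sum_{v\leftarrow\sigma_p(S_F\eta)}S_t([\Gamma'\mapsto v]\mathbin{++}\eta)$, with $p(v)=\mathrm{is\_btrue}(S_c([\Gamma'\mapsto v]\mathbin{++}\eta))$, $c$ and $\vec t$ evaluated in context $\Gamma',\Gamma$, deduplicated under DISTINCT (so the first FROM table has index $0$). $\mathtt{SELECT}~\ast$: same with $\vec t$ all terms $(i{ - }1).x$, $x\in\rho_i$, in order (which must evaluate), schema the concatenation of $\Gamma'$. Set operations on two queries with the same schema: UNION ALL $\oplus$, UNION $\|\oplus\|$, INTERSECT ALL $\cap$, INTERSECT $\|\cap\|$, EXCEPT ALL $\setminus$, EXCEPT $\|S_1\eta\|\setminus S_2\eta$. Nested queries (used by EXISTS) evaluate to whether $\mathtt{card}>0$ of the analogous relation, except that for $\mathtt{SELECT}~\ast$ the star terms are not evaluated. Conditions: TRUE$\mapsto$btrue, FALSE$\mapsto$bfalse; IS NULL $\mapsto\mathrm{of\_bool}(S_t\eta=\mathtt{NULL})$, IS NOT NULL its complement; $P^n(\vec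 t)$ (requires $|\vec t|=n$): bmaybe if some argument value is NULL, else $\mathrm{of\_bool}(P^n(\dots))$; EXISTS $Q\mapsto\mathrm{of\_bool}$ of the nested-query result; $\vec t~\mathtt{IN}~Q$ (with $Q$ of schema length $|\vec t|$): $\mathrm{of\_bool}(\mathrm{true})$ if some tuple $w$ of $S_Q\eta$ has $\mathrm{is\_btrue}(\mathrm{veq}(w_i,(S_{\vec t}\eta)_i))$ for all $i$, else bmaybe if some $w$ has $\neg\mathrm{is\_bfalse}(\mathrm{veq}(w_i,(S_{\vec t}\eta)_i))$ for all $i$, else $\mathrm{of\_bool}(\mathrm{false})$; NOT IN exchanges true and false in the of\_bool cases; AND, OR, NOT via the connectives of $\mathbf{B}$. -}

module Defs where

open import Data.Bool using (Bool; true; false; if_then_else_; not; _∧_; _∨_)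
open import Data.Nat using (ℕ; zero; suc; _<ᵇ_; _+_)
open import Data.List using (List; []; _∷_; _++_; map; concat; concatMap; length; take; drop; zipWith; filterᵇ; deduplicate; foldr)
open import Data.List.Properties using (≡-dec)
open import Data.Vec using (Vec; toList) renaming ([] to []v; _∷_ to _∷v_)
open import Data.Maybe using (Maybe; just; nothing; _>>=_; fromMaybe)
open import Data.Product using (_×_; _,_; proj₁; proj₂; Σ)
open import Relation.Binary.PropositionalEquality using (_≡_; refl; cong)
open import Relation.Binary.Definitions using (DecidableEquality)
open import Relation.Nullary using (yes; no; does)
open import Data.List.Relation.Unary.Unique.Propositional using (Unique)
open import Data.List.Relation.Unary.All using (All)

record TruthStructure : Set₁ where
  field
    Carrier   : Set
    btrue     : Carrier
    bfalse    : Carrier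
    bmaybe    : Carrier
    band      : Carrier → Carrier → Carrier
    bor       : Carrier → Carrier → Carrier
    bneg      : Carrier → Carrier
    is-btrue  : Carrier → Bool
    is-bfalse : Carrier → Bool
    of-bool   : Bool → Carrier

data Tribool : Set where
  ttrue tfalse unknown : Tribool

3VL : TruthStructure
3VL = record
  { Carrier = Tribool ; btrue = ttrue ; bfalse = tfalse ; bmaybe = unknown
  ; band = and3 ; bor = or3 ; bneg = not3
  ; is-btrue = λ { ttrue → true ; _ → false }
  ; is-bfalse = λ { tfalse → true ; _ → false }
  ; of-bool = λ { true → ttrue ; false → tfalse } }
  where
  and3 : Tribool → Tribool → Tribool
  and3 tfalse _ = tfalse
  and3 _ tfalse = tfalse
  and3 ttrue ttrue = ttrue
  and3 _ _ = unknown
  or3 : Tribool → Tribool → Tribool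
  or3 ttrue _ = ttrue
  or3 _ ttrue = ttrue
  or3 tfalse tfalse = tfalse
  or3 _ _ = unknown
  not3 : Tribool → Tribool
  not3 ttrue = tfalse
  not3 tfalse = ttrue
  not3 unknown = unknown

2VL : TruthStructure
2VL = record
  { Carrier = Bool ; btrue = true ; bfalse = false ; bmaybe = false
  ; band = _∧_ ; bor = _∨_ ; bneg = not
  ; is-btrue = λ b → b ; is-bfalse = not ; of-bool = λ b → b }

module SQL (Name : Set) (_≟N_ : DecidableEquality Name)
           (K : Set) (_≟K_ : DecidableEquality K) where

  data Val : Set where
    cst  : K → Val
    null : Val

  _≟V_ : DecidableEquality Val
  cst a ≟V cst b with a ≟K b
  ... | yes refl = yes refl
  ... | no ¬p = no λ { refl → ¬p refl }
  cst _ ≟V null = no λ ()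
  null ≟V cst _ = no λ ()
  null ≟V null = yes refl

  Schema : Set
  Schema = List Name

  Ctx : Set
  Ctx = List Schema

  Tuple : Set
  Tuple = List Val

  _≟T_ : DecidableEquality Tuple
  _≟T_ = ≡-dec _≟V_

  -- finite multisets of tuples, represented as lists; multiset equality
  -- is permutation equivalence (↭)
  Rel : Set
  Rel = List Tuple

  Env : Set
  Env = List (List Val)

  data EnvFor : Ctx → Env → Set where
    []  : EnvFor [] []
    _∷_ : ∀ {σ Γ vs η} → length vs ≡ length σ → EnvFor Γ η → EnvFor (σ ∷ Γ) (vs ∷ η)

  anyL : {A : Set} → (A → Bool) → List A → Bool
  anyL p [] = false
  anyL p (x ∷ xs) = p x ∨ anyL p xs

  allL : {A : Set} → (A → Bool) → List A → Bool
  allL p [] = true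
  allL p (x ∷ xs) = p x ∧ allL p xs

  occurrences : Name → Schema → ℕ
  occurrences x [] = 0
  occurrences x (y ∷ σ) = (if does (x ≟N y) then 1 else 0) + occurrences x σ

  data Tm : Set where
    att  : ℕ → Name → Tm
    cstT : K → Tm
    nullT : Tm

  data SetOp : Set where
    UNION INTERSECT EXCEPT : SetOp

  data Query : Set
  data Table : Set
  data Cond : Set

  data Query where
    -- Bool flag: true = DISTINCT
    select  : Bool → List (Tm × Name) → List (Table × Schema) → Cond → Query
    selstar : Bool → List (Table × Schema) → Cond → Query
    -- Bool flag: true = ALL
    setop   : SetOp → Bool → Query → Query → Query

  data Table where
    table : Name → Table
    query : Query → Table

  data Cond where
    TRUE FALSE  : Cond
    isnull      : Tm → Cond
    isnotnull   : Tm → Cond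
    inQ         : List Tm → Query → Cond
    notinQ      : List Tm → Query → Cond
    pred        : (n : ℕ) → (Vec K n → Bool) → Vec Tm n → Cond
    EXISTS      : Query → Cond
    AND OR      : Cond → Cond → Cond
    NOT         : Cond → Cond

  eqP : Vec K 2 → Bool
  eqP (a ∷v (b ∷v []v)) = does (a ≟K b)

  _=ₜ_ : Tm → Tm → Cond
  t =ₜ t' = pred 2 eqP (t ∷v (t' ∷v []v))

  -- Translation (·)^tt / (·)^ff, parametric in a supply of fresh names:
  -- fresh m = the pairwise distinct fresh names a₁,…,a_m

  incT : Tm → Tm
  incT (att n x) = att (suc n) x
  incT t = t

  nonNullChain : List Tm → Cond
  nonNullChain [] = TRUE
  nonNullChain (t ∷ ts) = AND (isnotnull t) (nonNullChain ts)

  inChain : List Tm → List Name → Cond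
  inChain (t ∷ ts) (a ∷ as) =
    AND (OR (isnull (att 0 a)) (OR (isnull (incT t)) (incT t =ₜ att 0 a)))
        (inChain ts as)
  inChain _ _ = TRUE

  module Translation (fresh : ℕ → List Name) where

    notInTrans : List Tm → Query → Cond
    notInTrans ts Q' =
      NOT (EXISTS (selstar false ((query Q' , fresh (length ts)) ∷ [])
                                 (inChain ts (fresh (length ts)))))

    ttQ : Query → Query
    ttF : List (Table × Schema) → List (Table × Schema)
    ttT : Table → Table
    ttC : Cond → Cond
    ffC : Cond → Cond

    ttQ (select d ts F c) = select d ts (ttF F) (ttC c)
    ttQ (selstar d F c) = selstar d (ttF F) (ttC c)
    ttQ (setop o a Q₁ Q₂) = setop o a (ttQ Q₁) (ttQ Q₂)

    ttF [] = []
    ttF ((T , σ) ∷ F) = (ttT T , σ) ∷ ttF F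

    ttT (table x) = table x
    ttT (query Q) = query (ttQ Q)

    ttC TRUE = TRUE
    ttC FALSE = FALSE
    ttC (isnull t) = isnull t
    ttC (isnotnull t) = isnotnull t
    ttC (inQ ts Q) = inQ ts (ttQ Q)
    ttC (notinQ ts Q) = notInTrans ts (ttQ Q)
    ttC (pred n P ts) = pred n P ts
    ttC (EXISTS Q) = EXISTS (ttQ Q)
    ttC (AND c₁ c₂) = AND (ttC c₁) (ttC c₂)
    ttC (OR c₁ c₂) = OR (ttC c₁) (ttC c₂)
    ttC (NOT c) = ffC c

    ffC TRUE = FALSE
    ffC FALSE = TRUE
    ffC (isnull t) = isnotnull t
    ffC (isnotnull t) = isnull t
    ffC (inQ ts Q) = notInTrans ts (ttQ Q)
    ffC (notinQ ts Q) = inQ ts (ttQ Q)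
    ffC (pred n P ts) = AND (NOT (pred n P ts)) (nonNullChain (toList ts))
    ffC (EXISTS Q) = NOT (EXISTS (ttQ Q))
    ffC (AND c₁ c₂) = OR (ffC c₁) (ffC c₂)
    ffC (OR c₁ c₂) = AND (ffC c₁) (ffC c₂)
    ffC (NOT c) = ttC c

  remove1 : Tuple → Rel → Rel
  remove1 t [] = []
  remove1 t (u ∷ r) = if does (t ≟T u) then r else u ∷ remove1 t r

  member : Tuple → Rel → Bool
  member t r = anyL (λ u → does (t ≟T u)) r

  _⊕_ : Rel → Rel → Rel
  _⊕_ = _++_

  -- ∩ (minimum of multiplicities)
  _∩_ : Rel → Rel → Rel
  [] ∩ s = []
  (t ∷ r) ∩ s = if member t s then t ∷ (r ∩ remove1 t s) else r ∩ s

  -- ∖ (truncated difference of multiplicities)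
  _∖_ : Rel → Rel → Rel
  [] ∖ s = []
  (t ∷ r) ∖ s = if member t s then r ∖ remove1 t s else t ∷ (r ∖ s)

  _×ᵣ_ : Rel → Rel → Rel
  r ×ᵣ s = concatMap (λ v → map (v ++_) s) r

  ‖_‖ : Rel → Rel
  ‖ r ‖ = deduplicate _≟T_ r

  card : Rel → ℕ
  card = length

  dedupIf : Bool → Rel → Rel
  dedupIf true r = ‖ r ‖
  dedupIf false r = r

  splitEnv : Ctx → Tuple → Env
  splitEnv [] v = []
  splitEnv (ρ ∷ Γ') v = take (length ρ) v ∷ splitEnv Γ' (drop (length ρ) v)

  nth : {A : Set} → List A → ℕ → Maybe A
  nth [] _ = nothing
  nth (x ∷ xs) zero = just x
  nth (x ∷ xs) (suc n) = nth xs n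

  indexOf : Name → Schema → Maybe ℕ
  indexOf x [] = nothing
  indexOf x (y ∷ σ) = if does (x ≟N y) then just 0 else (indexOf x σ >>= λ i → just (suc i))

  starTerms : ℕ → Ctx → List Tm
  starTerms i [] = []
  starTerms i (ρ ∷ Γ') = map (att i) ρ ++ starTerms (suc i) Γ'

  allCst : List Val → Maybe (List K)
  allCst [] = just []
  allCst (cst k ∷ vs) = allCst vs >>= λ ks → just (k ∷ ks)
  allCst (null ∷ vs) = nothing

  toVec : (n : ℕ) → List K → Maybe (Vec K n)
  toVec zero [] = just []v
  toVec (suc n) (k ∷ ks) = toVec n ks >>= λ v → just (k ∷v v)
  toVec _ _ = nothing

  isNullV : Val → Bool
  isNullV null = true
  isNullV (cst _) = false

  record Database : Set where
    field
      db : Name → Maybe (Σ Schema λ σ → Σ Rel λ r → All (λ t → length t ≡ length σ) r)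

  module Semantics (B : TruthStructure) (D : Database) where
    open TruthStructure B

    veq : Val → Val → Carrier
    veq null _ = bmaybe
    veq _ null = bmaybe
    veq (cst a) (cst b) = of-bool (does (a ≟K b))

    allB : (Carrier → Bool) → List Val → List Val → Bool
    allB f w vs = allL f (zipWith veq w vs)

    inSem : Bool → Rel → List Val → Carrier
    inSem pos r vs =
      if anyL (λ w → allB is-btrue w vs) r then of-bool pos
      else if anyL (λ w → allB (λ b → not (is-bfalse b)) w vs) r then bmaybe
      else of-bool (not pos)

    predSem : (n : ℕ) → (Vec K n → Bool) → List Val → Carrier
    predSem n P vs with allCst vs
    ... | nothing = bmaybe
    ... | just ks with toVec n ks
    ...   | nothing = bmaybe
    ...   | just v = of-bool (P v)

    setopSem : SetOp → Bool → Rel → Rel → Rel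
    setopSem UNION true r s = r ⊕ s
    setopSem UNION false r s = ‖ r ⊕ s ‖
    setopSem INTERSECT true r s = r ∩ s
    setopSem INTERSECT false r s = ‖ r ∩ s ‖
    setopSem EXCEPT true r s = r ∖ s
    setopSem EXCEPT false r s = ‖ r ‖ ∖ s

    data _⊢t_⇓_ : Ctx → Tm → (Env → Val) → Set where
      j-att  : ∀ {Γ n x σ i} → nth Γ n ≡ just σ → occurrences x σ ≡ 1 → indexOf x σ ≡ just i →
               Γ ⊢t att n x ⇓ (λ η → fromMaybe null (nth η n >>= λ vs → nth vs i))
      j-cst  : ∀ {Γ k} → Γ ⊢t cstT k ⇓ (λ _ → cst k)
      j-null : ∀ {Γ} → Γ ⊢t nullT ⇓ (λ _ → null)

    data _⊢ts_⇓_ : Ctx → List Tm → (Env → List Val) → Set where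
      j-nil  : ∀ {Γ} → Γ ⊢ts [] ⇓ (λ _ → [])
      j-cons : ∀ {Γ t ts St Sts} → Γ ⊢t t ⇓ St → Γ ⊢ts ts ⇓ Sts →
               Γ ⊢ts (t ∷ ts) ⇓ (λ η → St η ∷ Sts η)

    data _⊢q_∶_⇓_ : Ctx → Query → Schema → (Env → Rel) → Set
    data _⊢T_∶_⇓_ : Ctx → Table → Schema → (Env → Rel) → Set
    data _⊢F_∶_⇓_ : Ctx → List (Table × Schema) → Ctx → (Env → Rel) → Set
    data _⊢c_⇓_   : Ctx → Cond → (Env → Carrier) → Set
    data _⊢in_⇓_  : Ctx → Query → (Env → Bool) → Set

    selRel : Ctx → (Env → Rel) → (Env → Carrier) → Env → Rel
    selRel Γ' SF Sc η = filterᵇ (λ v → is-btrue (Sc (splitEnv Γ' v ++ η))) (SF η)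

    data _⊢q_∶_⇓_ where
      j-select : ∀ {Γ d btm F c Γ' SF Sc St} →
        Γ ⊢F F ∶ Γ' ⇓ SF → (Γ' ++ Γ) ⊢c c ⇓ Sc → (Γ' ++ Γ) ⊢ts map proj₁ btm ⇓ St →
        Γ ⊢q select d btm F c ∶ map proj₂ btm ⇓
          (λ η → dedupIf d (map (λ v → St (splitEnv Γ' v ++ η)) (selRel Γ' SF Sc η)))
      j-selstar : ∀ {Γ d F c Γ' SF Sc St} →
        Γ ⊢F F ∶ Γ' ⇓ SF → (Γ' ++ Γ) ⊢c c ⇓ Sc → (Γ' ++ Γ) ⊢ts starTerms 0 Γ' ⇓ St →
        Γ ⊢q selstar d F c ∶ concat Γ' ⇓
          (λ η → dedupIf d (map (λ v → St (splitEnv Γ' v ++ η)) (selRel Γ' SF Sc η)))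
      j-setop : ∀ {Γ o a Q₁ Q₂ τ S₁ S₂} →
        Γ ⊢q Q₁ ∶ τ ⇓ S₁ → Γ ⊢q Q₂ ∶ τ ⇓ S₂ →
        Γ ⊢q setop o a Q₁ Q₂ ∶ τ ⇓ (λ η → setopSem o a (S₁ η) (S₂ η))

    data _⊢T_∶_⇓_ where
      j-table : ∀ {Γ x σ r wf} → Database.db D x ≡ just (σ , r , wf) →
        Γ ⊢T table x ∶ σ ⇓ (λ _ → r)
      j-query : ∀ {Γ Q τ S} → Γ ⊢q Q ∶ τ ⇓ S → Γ ⊢T query Q ∶ τ ⇓ S

    data _⊢F_∶_⇓_ where
      j-from-nil  : ∀ {Γ} → Γ ⊢F [] ∶ [] ⇓ (λ _ → [] ∷ [])
      j-from-cons : ∀ {Γ T ρ F τ Γ' S S'} →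
        Γ ⊢T T ∶ τ ⇓ S → length τ ≡ length ρ → Γ ⊢F F ∶ Γ' ⇓ S' →
        Γ ⊢F (T , ρ) ∷ F ∶ ρ ∷ Γ' ⇓ (λ η → S η ×ᵣ S' η)

    data _⊢c_⇓_ where
      j-true  : ∀ {Γ} → Γ ⊢c TRUE ⇓ (λ _ → btrue)
      j-false : ∀ {Γ} → Γ ⊢c FALSE ⇓ (λ _ → bfalse)
      j-isnull : ∀ {Γ t St} → Γ ⊢t t ⇓ St →
        Γ ⊢c isnull t ⇓ (λ η → of-bool (isNullV (St η)))
      j-isnotnull : ∀ {Γ t St} → Γ ⊢t t ⇓ St →
        Γ ⊢c isnotnull t ⇓ (λ η → of-bool (not (isNullV (St η))))
      j-pred : ∀ {Γ n P ts St} → Γ ⊢ts toList ts ⇓ St →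
        Γ ⊢c pred n P ts ⇓ (λ η → predSem n P (St η))
      j-in : ∀ {Γ ts Q τ St SQ} → Γ ⊢ts ts ⇓ St → Γ ⊢q Q ∶ τ ⇓ SQ → length ts ≡ length τ →
        Γ ⊢c inQ ts Q ⇓ (λ η → inSem true (SQ η) (St η))
      j-notin : ∀ {Γ ts Q τ St SQ} → Γ ⊢ts ts ⇓ St → Γ ⊢q Q ∶ τ ⇓ SQ → length ts ≡ length τ →
        Γ ⊢c notinQ ts Q ⇓ (λ η → inSem false (SQ η) (St η))
      j-exists : ∀ {Γ Q S} → Γ ⊢in Q ⇓ S → Γ ⊢c EXISTS Q ⇓ (λ η → of-bool (S η))
      j-and : ∀ {Γ c₁ c₂ S₁ S₂} → Γ ⊢c c₁ ⇓ S₁ → Γ ⊢c c₂ ⇓ S₂ →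
        Γ ⊢c AND c₁ c₂ ⇓ (λ η → band (S₁ η) (S₂ η))
      j-or : ∀ {Γ c₁ c₂ S₁ S₂} → Γ ⊢c c₁ ⇓ S₁ → Γ ⊢c c₂ ⇓ S₂ →
        Γ ⊢c OR c₁ c₂ ⇓ (λ η → bor (S₁ η) (S₂ η))
      j-not : ∀ {Γ c S} → Γ ⊢c c ⇓ S → Γ ⊢c NOT c ⇓ (λ η → bneg (S η))

    data _⊢in_⇓_ where
      ji-select : ∀ {Γ d btm F c Γ' SF Sc St} →
        Γ ⊢F F ∶ Γ' ⇓ SF → (Γ' ++ Γ) ⊢c c ⇓ Sc → (Γ' ++ Γ) ⊢ts map proj₁ btm ⇓ St →
        Γ ⊢in select d btm F c ⇓
          (λ η → 0 <ᵇ card (dedupIf d (map (λ v → St (splitEnv Γ' v ++ η)) (selRel Γ' SF Sc η))))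
      ji-selstar : ∀ {Γ d F c Γ' SF Sc} →
        Γ ⊢F F ∶ Γ' ⇓ SF → (Γ' ++ Γ) ⊢c c ⇓ Sc →
        Γ ⊢in selstar d F c ⇓ (λ η → 0 <ᵇ card (dedupIf d (selRel Γ' SF Sc η)))
      ji-setop : ∀ {Γ o a Q₁ Q₂ τ S₁ S₂} →
        Γ ⊢q Q₁ ∶ τ ⇓ S₁ → Γ ⊢q Q₂ ∶ τ ⇓ S₂ →
        Γ ⊢in setop o a Q₁ Q₂ ⇓ (λ η → 0 <ᵇ card (setopSem o a (S₁ η) (S₂ η)))

  Eval : TruthStructure → Database → Ctx → Query → Schema → (Env → Rel) → Set
  Eval B D = Semantics._⊢q_∶_⇓_ B D

  FreshSupply : (ℕ → List Name) → Set
  FreshSupply fresh = ∀ m → length (fresh m) ≡ m × Unique (fresh m)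

-- By simultaneous induction on the 3VL evaluation: the translation of a query
-- evaluates in 2VL to the same relation, and for a condition c the 2VL values
-- of c^tt and c^ff are exactly "c is ttrue" and "c is tfalse" in Kleene logic.
-- Kleene's connectives make this compositional (is-btrue of an AND is the
-- conjunction of the is-btrue's, is-bfalse of an AND the disjunction of the
-- is-bfalse's, and dually for OR and NOT).  The one case needing an idea is
-- NOT IN, which is ttrue exactly when no tuple of the subquery may match: the
-- translation asks for the absence of a tuple whose every column is null or
-- equal to the corresponding term, and since the names a_i are fresh and
-- distinct, each 0.a_i really denotes the i-th column of that tuple.
module Submission where

open import Defs
open import Data.Bool using (Bool; true; false; not; _∧_; _∨_; if_then_else_)
open import Data.Bool.Properties using (not-involutive; ∧-identityʳ)
open import Data.Nat using (ℕ; zero; suc; _<ᵇ_)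
open import Data.Nat.Properties using (suc-injective)
open import Data.List using (List; []; _∷_; _++_; map; length; take; drop; filterᵇ; zipWith)
open import Data.List.Properties using (++-identityʳ; ++-assoc; length-++-comm; zipWith-zeroʳ)
open import Data.List.Relation.Unary.All using (All; []; _∷_)
import Data.List.Relation.Unary.All as All
open import Data.List.Relation.Unary.All.Properties using (++⁻ʳ)
open import Data.List.Relation.Unary.AllPairs using (_∷_)
open import Data.List.Relation.Unary.Unique.Propositional using (Unique)
open import Data.List.Relation.Binary.Permutation.Propositional using (_↭_; ↭-reflexive)
open import Data.Maybe using (just; nothing; fromMaybe)
open import Data.Product using (Σ; _×_; _,_; proj₁; proj₂)
open import Data.Vec using (Vec; toList)
open import Data.Vec.Properties using (length-toList)
open import Relation.Binary.Definitions using (DecidableEquality)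
open import Relation.Binary.PropositionalEquality
open import Relation.Nullary using (yes; no; contradiction)

open TruthStructure 3VL using (is-btrue; is-bfalse; of-bool; band; bor; bneg)

is-btrue-of-bool : ∀ b → is-btrue (of-bool b) ≡ b
is-btrue-of-bool true = refl
is-btrue-of-bool false = refl

is-bfalse-of-bool : ∀ b → is-bfalse (of-bool b) ≡ not b
is-bfalse-of-bool true = refl
is-bfalse-of-bool false = refl

is-btrue-band : ∀ x y → is-btrue (band x y) ≡ is-btrue x ∧ is-btrue y
is-btrue-band tfalse y = refl
is-btrue-band ttrue ttrue = refl
is-btrue-band ttrue tfalse = refl
is-btrue-band ttrue unknown = refl
is-btrue-band unknown ttrue = refl
is-btrue-band unknown tfalse = refl
is-btrue-band unknown unknown = refl

is-bfalse-band : ∀ x y → is-bfalse (band x y) ≡ is-bfalse x ∨ is-bfalse y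
is-bfalse-band tfalse y = refl
is-bfalse-band ttrue ttrue = refl
is-bfalse-band ttrue tfalse = refl
is-bfalse-band ttrue unknown = refl
is-bfalse-band unknown ttrue = refl
is-bfalse-band unknown tfalse = refl
is-bfalse-band unknown unknown = refl

is-btrue-bor : ∀ x y → is-btrue (bor x y) ≡ is-btrue x ∨ is-btrue y
is-btrue-bor ttrue y = refl
is-btrue-bor tfalse ttrue = refl
is-btrue-bor tfalse tfalse = refl
is-btrue-bor tfalse unknown = refl
is-btrue-bor unknown ttrue = refl
is-btrue-bor unknown tfalse = refl
is-btrue-bor unknown unknown = refl

is-bfalse-bor : ∀ x y → is-bfalse (bor x y) ≡ is-bfalse x ∧ is-bfalse y
is-bfalse-bor ttrue y = refl
is-bfalse-bor tfalse ttrue = refl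
is-bfalse-bor tfalse tfalse = refl
is-bfalse-bor tfalse unknown = refl
is-bfalse-bor unknown ttrue = refl
is-bfalse-bor unknown tfalse = refl
is-bfalse-bor unknown unknown = refl

is-btrue-bneg : ∀ x → is-btrue (bneg x) ≡ is-bfalse x
is-btrue-bneg ttrue = refl
is-btrue-bneg tfalse = refl
is-btrue-bneg unknown = refl

is-bfalse-bneg : ∀ x → is-bfalse (bneg x) ≡ is-btrue x
is-bfalse-bneg ttrue = refl
is-bfalse-bneg tfalse = refl
is-bfalse-bneg unknown = refl

-- The 3VL value of IN (pos = true) and NOT IN (pos = false), where a says
-- that some tuple certainly matches and m that some tuple may match.
is-btrue-membership : ∀ pos a m → (a ≡ true → m ≡ true) →
  is-btrue (if a then of-bool pos else if m then unknown else of-bool (not pos))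
    ≡ (if pos then a else not m)
is-btrue-membership true true m _ = refl
is-btrue-membership true false true _ = refl
is-btrue-membership true false false _ = refl
is-btrue-membership false true m a⇒m rewrite a⇒m refl = refl
is-btrue-membership false false true _ = refl
is-btrue-membership false false false _ = refl

is-bfalse-membership : ∀ pos a m → (a ≡ true → m ≡ true) →
  is-bfalse (if a then of-bool pos else if m then unknown else of-bool (not pos))
    ≡ (if pos then not m else a)
is-bfalse-membership true true m a⇒m rewrite a⇒m refl = refl
is-bfalse-membership true false true _ = refl
is-bfalse-membership true false false _ = refl
is-bfalse-membership false true m _ = refl
is-bfalse-membership false false true _ = refl
is-bfalse-membership false false false _ = refl

if-then-true-else-false : ∀ a m → (if a then true else if m then false else false) ≡ a
if-then-true-else-false true m = refl
if-then-true-else-false false true = refl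
if-then-true-else-false false false = refl

filterᵇ-cong : ∀ {A : Set} {p q : A → Bool} → (∀ x → p x ≡ q x) → ∀ xs → filterᵇ p xs ≡ filterᵇ q xs
filterᵇ-cong p≗q [] = refl
filterᵇ-cong {q = q} p≗q (x ∷ xs) rewrite p≗q x with q x
... | true = cong (x ∷_) (filterᵇ-cong p≗q xs)
... | false = filterᵇ-cong p≗q xs

zipWith-takeˡ : ∀ {A B C : Set} (f : A → B → C) xs ys →
  zipWith f (take (length ys) xs) ys ≡ zipWith f xs ys
zipWith-takeˡ f [] [] = refl
zipWith-takeˡ f [] (y ∷ ys) = refl
zipWith-takeˡ f (x ∷ xs) [] = refl
zipWith-takeˡ f (x ∷ xs) (y ∷ ys) = cong (f x y ∷_) (zipWith-takeˡ f xs ys)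

module Correctness (Name : Set) (_≟N_ : DecidableEquality Name)
                   (K : Set) (_≟K_ : DecidableEquality K)
                   (fresh : ℕ → List Name)
                   (fresh-supply : SQL.FreshSupply Name _≟N_ K _≟K_ fresh)
                   (D : SQL.Database Name _≟N_ K _≟K_) where
  open SQL Name _≟N_ K _≟K_
  open Translation fresh
  module S3 = Semantics 3VL D
  module S2 = Semantics 2VL D
  open S3 using () renaming (_⊢t_⇓_ to _⊢t3_⇓_; _⊢ts_⇓_ to _⊢ts3_⇓_; _⊢q_∶_⇓_ to _⊢q3_∶_⇓_;
    _⊢T_∶_⇓_ to _⊢T3_∶_⇓_; _⊢F_∶_⇓_ to _⊢F3_∶_⇓_; _⊢c_⇓_ to _⊢c3_⇓_; _⊢in_⇓_ to _⊢in3_⇓_)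
  open S2 using () renaming (_⊢t_⇓_ to _⊢t2_⇓_; _⊢ts_⇓_ to _⊢ts2_⇓_; _⊢q_∶_⇓_ to _⊢q2_∶_⇓_;
    _⊢T_∶_⇓_ to _⊢T2_∶_⇓_; _⊢F_∶_⇓_ to _⊢F2_∶_⇓_; _⊢c_⇓_ to _⊢c2_⇓_; _⊢in_⇓_ to _⊢in2_⇓_)

  _⊢q2_∶_⇓≗_ : Ctx → Query → Schema → (Env → Rel) → Set
  Γ ⊢q2 Q ∶ τ ⇓≗ S = Σ (Env → Rel) λ S' → Γ ⊢q2 Q ∶ τ ⇓ S' × (∀ η → S' η ≡ S η)

  _⊢T2_∶_⇓≗_ : Ctx → Table → Schema → (Env → Rel) → Set
  Γ ⊢T2 T ∶ τ ⇓≗ S = Σ (Env → Rel) λ S' → Γ ⊢T2 T ∶ τ ⇓ S' × (∀ η → S' η ≡ S η)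

  _⊢F2_∶_⇓≗_ : Ctx → List (Table × Schema) → Ctx → (Env → Rel) → Set
  Γ ⊢F2 F ∶ Γ' ⇓≗ S = Σ (Env → Rel) λ S' → Γ ⊢F2 F ∶ Γ' ⇓ S' × (∀ η → S' η ≡ S η)

  _⊢in2_⇓≗_ : Ctx → Query → (Env → Bool) → Set
  Γ ⊢in2 Q ⇓≗ f = Σ (Env → Bool) λ S → Γ ⊢in2 Q ⇓ S × (∀ η → S η ≡ f η)

  _⊢c2_⇓≗_ : Ctx → Cond → (Env → Bool) → Set
  Γ ⊢c2 c ⇓≗ f = Σ (Env → Bool) λ S → Γ ⊢c2 c ⇓ S × (∀ η → S η ≡ f η)

  ⇓≗-resp : ∀ {Γ c f g} → (∀ η → f η ≡ g η) → Γ ⊢c2 c ⇓≗ f → Γ ⊢c2 c ⇓≗ g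
  ⇓≗-resp f≗g (S , c⇓ , S≗f) = S , c⇓ , λ η → trans (S≗f η) (f≗g η)

  and-⇓≗ : ∀ {Γ c₁ c₂ f₁ f₂} → Γ ⊢c2 c₁ ⇓≗ f₁ → Γ ⊢c2 c₂ ⇓≗ f₂ →
    Γ ⊢c2 AND c₁ c₂ ⇓≗ (λ η → f₁ η ∧ f₂ η)
  and-⇓≗ (_ , c₁⇓ , e₁) (_ , c₂⇓ , e₂) = _ , S2.j-and c₁⇓ c₂⇓ , λ η → cong₂ _∧_ (e₁ η) (e₂ η)

  or-⇓≗ : ∀ {Γ c₁ c₂ f₁ f₂} → Γ ⊢c2 c₁ ⇓≗ f₁ → Γ ⊢c2 c₂ ⇓≗ f₂ →
    Γ ⊢c2 OR c₁ c₂ ⇓≗ (λ η → f₁ η ∨ f₂ η)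
  or-⇓≗ (_ , c₁⇓ , e₁) (_ , c₂⇓ , e₂) = _ , S2.j-or c₁⇓ c₂⇓ , λ η → cong₂ _∨_ (e₁ η) (e₂ η)

  not-⇓≗ : ∀ {Γ c f} → Γ ⊢c2 c ⇓≗ f → Γ ⊢c2 NOT c ⇓≗ (λ η → not (f η))
  not-⇓≗ (_ , c⇓ , e) = _ , S2.j-not c⇓ , λ η → cong not (e η)

  exists-⇓≗ : ∀ {Γ Q f} → Γ ⊢in2 Q ⇓≗ f → Γ ⊢c2 EXISTS Q ⇓≗ f
  exists-⇓≗ (_ , Q⇓ , e) = _ , S2.j-exists Q⇓ , e

  anyL-cong : ∀ {A : Set} {p q : A → Bool} → (∀ x → p x ≡ q x) → ∀ xs → anyL p xs ≡ anyL q xs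
  anyL-cong p≗q [] = refl
  anyL-cong p≗q (x ∷ xs) = cong₂ _∨_ (p≗q x) (anyL-cong p≗q xs)

  anyL-mono : ∀ {A : Set} {p q : A → Bool} → (∀ x → p x ≡ true → q x ≡ true) →
    ∀ xs → anyL p xs ≡ true → anyL q xs ≡ true
  anyL-mono p⇒q [] ()
  anyL-mono {p = p} {q} p⇒q (x ∷ xs) any-p with p x in px
  ... | true rewrite p⇒q x px = refl
  ... | false with q x
  ...   | true = refl
  ...   | false = anyL-mono p⇒q xs any-p

  term-2VL : ∀ {Γ t St} → Γ ⊢t3 t ⇓ St → Γ ⊢t2 t ⇓ St
  term-2VL (S3.j-att n-th unique index) = S2.j-att n-th unique index
  term-2VL S3.j-cst = S2.j-cst
  term-2VL S3.j-null = S2.j-null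

  terms-2VL : ∀ {Γ ts St} → Γ ⊢ts3 ts ⇓ St → Γ ⊢ts2 ts ⇓ St
  terms-2VL S3.j-nil = S2.j-nil
  terms-2VL (S3.j-cons t⇓ ts⇓) = S2.j-cons (term-2VL t⇓) (terms-2VL ts⇓)

  length-terms : ∀ {Γ ts St} → Γ ⊢ts2 ts ⇓ St → ∀ η → length (St η) ≡ length ts
  length-terms S2.j-nil η = refl
  length-terms (S2.j-cons t⇓ ts⇓) η = cong suc (length-terms ts⇓ η)

  incT-⇓ : ∀ {Γ σ t St} → Γ ⊢t2 t ⇓ St →
    Σ (Env → Val) λ St⁺ → (σ ∷ Γ) ⊢t2 incT t ⇓ St⁺ × (∀ vs η → St⁺ (vs ∷ η) ≡ St η)
  incT-⇓ (S2.j-att n-th unique index) = _ , S2.j-att n-th unique index , λ _ _ → refl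
  incT-⇓ S2.j-cst = _ , S2.j-cst , λ _ _ → refl
  incT-⇓ S2.j-null = _ , S2.j-null , λ _ _ → refl

  isNonNull : Val → Bool
  isNonNull v = not (isNullV v)

  nonNullChain-⇓ : ∀ {Γ ts St} → Γ ⊢ts2 ts ⇓ St →
    Γ ⊢c2 nonNullChain ts ⇓≗ (λ η → allL isNonNull (St η))
  nonNullChain-⇓ S2.j-nil = _ , S2.j-true , λ _ → refl
  nonNullChain-⇓ (S2.j-cons t⇓ ts⇓) = and-⇓≗ (_ , S2.j-isnotnull t⇓ , λ _ → refl) (nonNullChain-⇓ ts⇓)

  pred-tt : ∀ n P vs → S2.predSem n P vs ≡ is-btrue (S3.predSem n P vs)
  pred-tt n P vs with allCst vs
  ... | nothing = refl
  ... | just ks with toVec n ks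
  ...   | nothing = refl
  ...   | just v = sym (is-btrue-of-bool (P v))

  allCst-nothing : ∀ vs → allCst vs ≡ nothing → allL isNonNull vs ≡ false
  allCst-nothing (null ∷ vs) _ = refl
  allCst-nothing (cst k ∷ vs) eq with allCst vs in eq'
  ... | nothing = allCst-nothing vs eq'

  allCst-just : ∀ vs {ks} → allCst vs ≡ just ks → allL isNonNull vs ≡ true × length ks ≡ length vs
  allCst-just [] refl = refl , refl
  allCst-just (cst k ∷ vs) eq with allCst vs in eq'
  allCst-just (cst k ∷ vs) refl | just ks =
    let (nonNull , len) = allCst-just vs eq' in nonNull , cong suc len

  toVec-length : ∀ n ks → length ks ≡ n → Σ (Vec K n) λ v → toVec n ks ≡ just v
  toVec-length zero [] _ = _ , refl
  toVec-length (suc n) (k ∷ ks) len with toVec-length n ks (suc-injective len)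
  ... | v , eq rewrite eq = _ , refl

  -- In 2VL "NOT P" also holds when an argument is null; "is tfalse" needs them all non-null.
  pred-ff : ∀ n P vs → length vs ≡ n →
    not (S2.predSem n P vs) ∧ allL isNonNull vs ≡ is-bfalse (S3.predSem n P vs)
  pred-ff n P vs len with allCst vs in eq
  ... | nothing rewrite allCst-nothing vs eq = refl
  ... | just ks with allCst-just vs eq
  ...   | nonNull , len-ks rewrite nonNull with toVec n ks | toVec-length n ks (trans len-ks len)
  ...     | just v | _ = trans (∧-identityʳ (not (P v))) (sym (is-bfalse-of-bool (P v)))
  ...     | nothing | _ , ()

  matches : Tuple → List Val → Bool
  matches w vs = S3.allB is-btrue w vs

  mayMatch : Tuple → List Val → Bool
  mayMatch w vs = S3.allB (λ b → not (is-bfalse b)) w vs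

  matches⇒mayMatch : ∀ w vs → matches w vs ≡ true → mayMatch w vs ≡ true
  matches⇒mayMatch (a ∷ w) (x ∷ xs) m with S3.veq a x
  ... | ttrue = matches⇒mayMatch w xs m
  matches⇒mayMatch [] vs _ = refl
  matches⇒mayMatch (a ∷ w) [] _ = refl

  someMatch : Rel → List Val → Bool
  someMatch r vs = anyL (λ w → matches w vs) r

  someMayMatch : Rel → List Val → Bool
  someMayMatch r vs = anyL (λ w → mayMatch w vs) r

  someMatch⇒someMayMatch : ∀ r vs → someMatch r vs ≡ true → someMayMatch r vs ≡ true
  someMatch⇒someMayMatch r vs = anyL-mono (λ w → matches⇒mayMatch w vs) r

  veq-2VL : ∀ a x → S2.veq a x ≡ is-btrue (S3.veq a x)
  veq-2VL null x = refl
  veq-2VL (cst a) null = refl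
  veq-2VL (cst a) (cst x) = sym (is-btrue-of-bool _)

  matches-2VL : ∀ w vs → S2.allB (λ b → b) w vs ≡ matches w vs
  matches-2VL (a ∷ w) (x ∷ xs) = cong₂ _∧_ (veq-2VL a x) (matches-2VL w xs)
  matches-2VL [] vs = refl
  matches-2VL (a ∷ w) [] = refl

  in-⇓ : ∀ {Γ ts Q τ St SQ} → Γ ⊢ts2 ts ⇓ St → Γ ⊢q2 Q ∶ τ ⇓≗ SQ → length ts ≡ length τ →
    Γ ⊢c2 inQ ts Q ⇓≗ (λ η → someMatch (SQ η) (St η))
  in-⇓ {St = St} {SQ} ts⇓ (SQ' , Q⇓ , SQ'≗SQ) len = _ , S2.j-in ts⇓ Q⇓ len , value
    where
    value : ∀ η → S2.inSem true (SQ' η) (St η) ≡ someMatch (SQ η) (St η)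
    value η rewrite SQ'≗SQ η =
      trans (if-then-true-else-false _ _) (anyL-cong (λ w → matches-2VL w (St η)) (SQ η))

  occurrences-absent : ∀ {a σ} → All (a ≢_) σ → occurrences a σ ≡ 0
  occurrences-absent [] = refl
  occurrences-absent {a} {y ∷ σ} (a≢y ∷ a∉σ) with a ≟N y
  ... | yes a≡y = contradiction a≡y a≢y
  ... | no _ = occurrences-absent a∉σ

  occurrences-unique : ∀ pre {a post} → Unique (pre ++ a ∷ post) → occurrences a (pre ++ a ∷ post) ≡ 1
  occurrences-unique [] {a} (a∉post ∷ _) with a ≟N a
  ... | yes _ = cong suc (occurrences-absent a∉post)
  ... | no a≢a = contradiction refl a≢a
  occurrences-unique (p ∷ pre) {a} (p∉ ∷ unique) with a ≟N p
  ... | yes refl = contradiction refl (All.head (++⁻ʳ pre p∉))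
  ... | no _ = occurrences-unique pre unique

  indexOf-unique : ∀ pre {a post} → Unique (pre ++ a ∷ post) → indexOf a (pre ++ a ∷ post) ≡ just (length pre)
  indexOf-unique [] {a} _ with a ≟N a
  ... | yes _ = refl
  ... | no a≢a = contradiction refl a≢a
  indexOf-unique (p ∷ pre) {a} (p∉ ∷ unique) with a ≟N p
  ... | yes refl = contradiction refl (All.head (++⁻ʳ pre p∉))
  ... | no _ rewrite indexOf-unique pre unique = refl

  nullOrEqual-2VL : ∀ a x →
    isNullV a ∨ (isNullV x ∨ S2.predSem 2 eqP (x ∷ a ∷ [])) ≡ not (is-bfalse (S3.veq a x))
  nullOrEqual-2VL null x = refl
  nullOrEqual-2VL (cst a) null = refl
  nullOrEqual-2VL (cst a) (cst x) with a ≟K x | x ≟K a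
  ... | yes refl | yes _ = refl
  ... | yes refl | no x≢x = contradiction refl x≢x
  ... | no a≢a | yes refl = contradiction refl a≢a
  ... | no _ | no _ = refl

  -- A missing column (nth beyond the end) reads as null, which may match anything,
  -- just as zipWith ignores the columns beyond the end of the tuple.
  mayMatch-drop : ∀ k w x xs →
    not (is-bfalse (S3.veq (fromMaybe null (nth w k)) x)) ∧ mayMatch (drop (suc k) w) xs
      ≡ mayMatch (drop k w) (x ∷ xs)
  mayMatch-drop zero [] x xs = refl
  mayMatch-drop (suc k) [] x xs = refl
  mayMatch-drop zero (a ∷ w) x xs = refl
  mayMatch-drop (suc k) (a ∷ w) x xs = mayMatch-drop k w x xs

  mayMatch-[] : ∀ w → mayMatch w [] ≡ true
  mayMatch-[] w = cong (allL _) (zipWith-zeroʳ S3.veq w)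

  -- σ = pre ++ as lists the column names of the tuple w; the chain for the
  -- columns as starts at column length pre.
  inChain-⇓ : ∀ {Γ ts St} σ pre as → σ ≡ pre ++ as → Unique σ → length ts ≡ length as →
    Γ ⊢ts2 ts ⇓ St →
    Σ (Env → Bool) λ Sc → (σ ∷ Γ) ⊢c2 inChain ts as ⇓ Sc ×
      (∀ w η → Sc (w ∷ η) ≡ mayMatch (drop (length pre) w) (St η))
  inChain-⇓ σ pre [] _ _ _ S2.j-nil = _ , S2.j-true , λ w _ → sym (mayMatch-[] (drop (length pre) w))
  inChain-⇓ σ pre [] _ _ () (S2.j-cons _ _)
  inChain-⇓ σ pre (a ∷ as) _ _ () S2.j-nil
  inChain-⇓ σ pre (a ∷ as) refl unique len (S2.j-cons {St = St₁} {Sts = Sts} t⇓ ts⇓) =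
    _ , S2.j-and (S2.j-or (S2.j-isnull a⇓) (S2.j-or (S2.j-isnull t⁺⇓) (S2.j-pred (S2.j-cons t⁺⇓ (S2.j-cons a⇓ S2.j-nil)))))
                 rest⇓ ,
    value
    where
    k = length pre
    a⇓ = S2.j-att refl (occurrences-unique pre unique) (indexOf-unique pre unique)
    t⁺ = incT-⇓ t⇓
    t⁺⇓ = proj₁ (proj₂ t⁺)
    rest = inChain-⇓ σ (pre ++ a ∷ []) as (sym (++-assoc pre (a ∷ []) as)) unique (suc-injective len) ts⇓
    rest⇓ = proj₁ (proj₂ rest)
    value : ∀ w η →
      (isNullV (fromMaybe null (nth w k)) ∨ (isNullV (proj₁ t⁺ (w ∷ η)) ∨
        S2.predSem 2 eqP (proj₁ t⁺ (w ∷ η) ∷ fromMaybe null (nth w k) ∷ []))) ∧ proj₁ rest (w ∷ η)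
      ≡ mayMatch (drop k w) (St₁ η ∷ Sts η)
    value w η = begin
      (isNullV a' ∨ (isNullV (proj₁ t⁺ (w ∷ η)) ∨ S2.predSem 2 eqP (proj₁ t⁺ (w ∷ η) ∷ a' ∷ []))) ∧ proj₁ rest (w ∷ η)
        ≡⟨ cong₂ (λ x b → (isNullV a' ∨ (isNullV x ∨ S2.predSem 2 eqP (x ∷ a' ∷ []))) ∧ b)
                 (proj₂ (proj₂ t⁺) w η) (proj₂ (proj₂ rest) w η) ⟩
      (isNullV a' ∨ (isNullV (St₁ η) ∨ S2.predSem 2 eqP (St₁ η ∷ a' ∷ []))) ∧ mayMatch (drop (length (pre ++ a ∷ [])) w) (Sts η)
        ≡⟨ cong₂ _∧_ (nullOrEqual-2VL a' (St₁ η)) (cong (λ n → mayMatch (drop n w) (Sts η)) (length-++-comm pre (a ∷ []))) ⟩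
      not (is-bfalse (S3.veq a' (St₁ η))) ∧ mayMatch (drop (suc k) w) (Sts η)
        ≡⟨ mayMatch-drop k w (St₁ η) (Sts η) ⟩
      mayMatch (drop k w) (St₁ η ∷ Sts η) ∎
      where
      open ≡-Reasoning
      a' = fromMaybe null (nth w k)

  exists-single-table : ∀ (p : Tuple → Bool) r →
    (0 <ᵇ length (filterᵇ p (r ×ᵣ ([] ∷ [])))) ≡ anyL (λ w → p (w ++ [])) r
  exists-single-table p [] = refl
  exists-single-table p (w ∷ r) with p (w ++ [])
  ... | true = refl
  ... | false = exists-single-table p r

  notIn-⇓ : ∀ {Γ ts Q τ St SQ} → Γ ⊢ts2 ts ⇓ St → Γ ⊢q2 Q ∶ τ ⇓≗ SQ → length ts ≡ length τ →
    Γ ⊢c2 notInTrans ts Q ⇓≗ (λ η → not (someMayMatch (SQ η) (St η)))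
  notIn-⇓ {ts = ts} {St = St} {SQ} ts⇓ (SQ' , Q⇓ , SQ'≗SQ) len =
    _ , S2.j-not (S2.j-exists (S2.ji-selstar (S2.j-from-cons (S2.j-query Q⇓) τ≡σ S2.j-from-nil) chain⇓)) ,
    λ η → cong not (value η)
    where
    σ = fresh (length ts)
    length-σ : length σ ≡ length ts
    length-σ = proj₁ (fresh-supply (length ts))
    τ≡σ = trans (sym len) (sym length-σ)
    chain = inChain-⇓ σ [] σ refl (proj₂ (fresh-supply (length ts))) (sym length-σ) ts⇓
    chain⇓ = proj₁ (proj₂ chain)
    value : ∀ η →
      (0 <ᵇ length (filterᵇ (λ v → proj₁ chain (take (length σ) v ∷ η)) (SQ' η ×ᵣ ([] ∷ []))))
        ≡ someMayMatch (SQ η) (St η)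
    value η = begin
      (0 <ᵇ length (filterᵇ (λ v → proj₁ chain (take (length σ) v ∷ η)) (SQ' η ×ᵣ ([] ∷ []))))
        ≡⟨ exists-single-table _ (SQ' η) ⟩
      anyL (λ w → proj₁ chain (take (length σ) (w ++ []) ∷ η)) (SQ' η)
        ≡⟨ anyL-cong column-chain (SQ' η) ⟩
      someMayMatch (SQ' η) (St η)
        ≡⟨ cong (λ r → someMayMatch r (St η)) (SQ'≗SQ η) ⟩
      someMayMatch (SQ η) (St η) ∎
      where
      open ≡-Reasoning
      length-σ-St : length σ ≡ length (St η)
      length-σ-St = trans length-σ (sym (length-terms ts⇓ η))
      column-chain : ∀ w → proj₁ chain (take (length σ) (w ++ []) ∷ η) ≡ mayMatch w (St η)
      column-chain w = begin
        proj₁ chain (take (length σ) (w ++ []) ∷ η)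
          ≡⟨ proj₂ (proj₂ chain) _ η ⟩
        mayMatch (take (length σ) (w ++ [])) (St η)
          ≡⟨ cong₂ (λ n u → mayMatch (take n u) (St η)) length-σ-St (++-identityʳ w) ⟩
        mayMatch (take (length (St η)) w) (St η)
          ≡⟨ cong (allL _) (zipWith-takeˡ S3.veq w (St η)) ⟩
        mayMatch w (St η) ∎

  selRel-tt : ∀ Γ' {SF SF' Sc Sc'} → (∀ η → SF' η ≡ SF η) → (∀ η → Sc' η ≡ is-btrue (Sc η)) →
    ∀ η → S2.selRel Γ' SF' Sc' η ≡ S3.selRel Γ' SF Sc η
  selRel-tt Γ' {SF} SF'≗SF Sc'≗Sc η rewrite SF'≗SF η = filterᵇ-cong (λ v → Sc'≗Sc (splitEnv Γ' v ++ η)) (SF η)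

  CondTranslation : Ctx → Cond → (Env → Tribool) → Set
  CondTranslation Γ c Sc =
    Γ ⊢c2 ttC c ⇓≗ (λ η → is-btrue (Sc η)) × Γ ⊢c2 ffC c ⇓≗ (λ η → is-bfalse (Sc η))

  tt-query : ∀ {Γ Q τ S} → Γ ⊢q3 Q ∶ τ ⇓ S → Γ ⊢q2 ttQ Q ∶ τ ⇓≗ S
  tt-table : ∀ {Γ T τ S} → Γ ⊢T3 T ∶ τ ⇓ S → Γ ⊢T2 ttT T ∶ τ ⇓≗ S
  tt-from : ∀ {Γ F Γ' S} → Γ ⊢F3 F ∶ Γ' ⇓ S → Γ ⊢F2 ttF F ∶ Γ' ⇓≗ S
  tt-nonempty : ∀ {Γ Q S} → Γ ⊢in3 Q ⇓ S → Γ ⊢in2 ttQ Q ⇓≗ S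
  tt-cond : ∀ {Γ c Sc} → Γ ⊢c3 c ⇓ Sc → CondTranslation Γ c Sc

  tt-query (S3.j-select {d = d} {Γ' = Γ'} {St = St} F⇓ c⇓ ts⇓) =
    let (_ , F⇓' , SF'≗SF) = tt-from F⇓
        (_ , c⇓' , Sc'≗Sc) = proj₁ (tt-cond c⇓)
    in _ , S2.j-select F⇓' c⇓' (terms-2VL ts⇓) ,
       λ η → cong (λ r → dedupIf d (map (λ v → St (splitEnv Γ' v ++ η)) r)) (selRel-tt Γ' SF'≗SF Sc'≗Sc η)
  tt-query (S3.j-selstar {d = d} {Γ' = Γ'} {St = St} F⇓ c⇓ ts⇓) =
    let (_ , F⇓' , SF'≗SF) = tt-from F⇓
        (_ , c⇓' , Sc'≗Sc) = proj₁ (tt-cond c⇓)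
    in _ , S2.j-selstar F⇓' c⇓' (terms-2VL ts⇓) ,
       λ η → cong (λ r → dedupIf d (map (λ v → St (splitEnv Γ' v ++ η)) r)) (selRel-tt Γ' SF'≗SF Sc'≗Sc η)
  tt-query (S3.j-setop {o = o} {a = a} Q₁⇓ Q₂⇓) =
    let (_ , Q₁⇓' , e₁) = tt-query Q₁⇓
        (_ , Q₂⇓' , e₂) = tt-query Q₂⇓
    in _ , S2.j-setop Q₁⇓' Q₂⇓' , λ η → cong₂ (S3.setopSem o a) (e₁ η) (e₂ η)

  tt-table (S3.j-table x∈D) = _ , S2.j-table x∈D , λ _ → refl
  tt-table (S3.j-query Q⇓) = let (_ , Q⇓' , e) = tt-query Q⇓ in _ , S2.j-query Q⇓' , e

  tt-from S3.j-from-nil = _ , S2.j-from-nil , λ _ → refl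
  tt-from (S3.j-from-cons T⇓ len F⇓) =
    let (_ , T⇓' , e₁) = tt-table T⇓
        (_ , F⇓' , e₂) = tt-from F⇓
    in _ , S2.j-from-cons T⇓' len F⇓' , λ η → cong₂ _×ᵣ_ (e₁ η) (e₂ η)

  tt-nonempty (S3.ji-select {d = d} {Γ' = Γ'} {St = St} F⇓ c⇓ ts⇓) =
    let (_ , F⇓' , SF'≗SF) = tt-from F⇓
        (_ , c⇓' , Sc'≗Sc) = proj₁ (tt-cond c⇓)
    in _ , S2.ji-select F⇓' c⇓' (terms-2VL ts⇓) ,
       λ η → cong (λ r → 0 <ᵇ card (dedupIf d (map (λ v → St (splitEnv Γ' v ++ η)) r))) (selRel-tt Γ' SF'≗SF Sc'≗Sc η)
  tt-nonempty (S3.ji-selstar {d = d} {Γ' = Γ'} F⇓ c⇓) =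
    let (_ , F⇓' , SF'≗SF) = tt-from F⇓
        (_ , c⇓' , Sc'≗Sc) = proj₁ (tt-cond c⇓)
    in _ , S2.ji-selstar F⇓' c⇓' , λ η → cong (λ r → 0 <ᵇ card (dedupIf d r)) (selRel-tt Γ' SF'≗SF Sc'≗Sc η)
  tt-nonempty (S3.ji-setop {o = o} {a = a} Q₁⇓ Q₂⇓) =
    let (_ , Q₁⇓' , e₁) = tt-query Q₁⇓
        (_ , Q₂⇓' , e₂) = tt-query Q₂⇓
    in _ , S2.ji-setop Q₁⇓' Q₂⇓' , λ η → cong (λ r → 0 <ᵇ card r) (cong₂ (S3.setopSem o a) (e₁ η) (e₂ η))

  tt-cond S3.j-true = (_ , S2.j-true , λ _ → refl) , (_ , S2.j-false , λ _ → refl)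
  tt-cond S3.j-false = (_ , S2.j-false , λ _ → refl) , (_ , S2.j-true , λ _ → refl)
  tt-cond (S3.j-isnull t⇓) =
    (_ , S2.j-isnull (term-2VL t⇓) , λ _ → sym (is-btrue-of-bool _)) ,
    (_ , S2.j-isnotnull (term-2VL t⇓) , λ _ → sym (is-bfalse-of-bool _))
  tt-cond (S3.j-isnotnull t⇓) =
    (_ , S2.j-isnotnull (term-2VL t⇓) , λ _ → sym (is-btrue-of-bool _)) ,
    (_ , S2.j-isnull (term-2VL t⇓) , λ _ → sym (trans (is-bfalse-of-bool _) (not-involutive _)))
  tt-cond (S3.j-pred {n = n} {P = P} {ts = ts} {St = St} ts⇓) =
    (_ , pred⇓ , λ η → pred-tt n P (St η)) ,
    ⇓≗-resp (λ η → pred-ff n P (St η) (trans (length-terms ts⇓' η) (length-toList ts)))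
            (and-⇓≗ (not-⇓≗ (_ , pred⇓ , λ _ → refl)) (nonNullChain-⇓ ts⇓'))
    where
    ts⇓' = terms-2VL ts⇓
    pred⇓ = S2.j-pred ts⇓'
  tt-cond (S3.j-in {St = St} {SQ = SQ} ts⇓ Q⇓ len) =
    ⇓≗-resp (λ η → sym (is-btrue-membership true _ _ (someMatch⇒someMayMatch (SQ η) (St η))))
            (in-⇓ (terms-2VL ts⇓) (tt-query Q⇓) len) ,
    ⇓≗-resp (λ η → sym (is-bfalse-membership true _ _ (someMatch⇒someMayMatch (SQ η) (St η))))
            (notIn-⇓ (terms-2VL ts⇓) (tt-query Q⇓) len)
  tt-cond (S3.j-notin {St = St} {SQ = SQ} ts⇓ Q⇓ len) =
    ⇓≗-resp (λ η → sym (is-btrue-membership false _ _ (someMatch⇒someMayMatch (SQ η) (St η))))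
            (notIn-⇓ (terms-2VL ts⇓) (tt-query Q⇓) len) ,
    ⇓≗-resp (λ η → sym (is-bfalse-membership false _ _ (someMatch⇒someMayMatch (SQ η) (St η))))
            (in-⇓ (terms-2VL ts⇓) (tt-query Q⇓) len)
  tt-cond (S3.j-exists Q⇓) =
    ⇓≗-resp (λ _ → sym (is-btrue-of-bool _)) (exists-⇓≗ (tt-nonempty Q⇓)) ,
    ⇓≗-resp (λ _ → sym (is-bfalse-of-bool _)) (not-⇓≗ (exists-⇓≗ (tt-nonempty Q⇓)))
  tt-cond (S3.j-and c₁⇓ c₂⇓) =
    let (tt₁ , ff₁) = tt-cond c₁⇓
        (tt₂ , ff₂) = tt-cond c₂⇓
    in ⇓≗-resp (λ _ → sym (is-btrue-band _ _)) (and-⇓≗ tt₁ tt₂) ,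
       ⇓≗-resp (λ _ → sym (is-bfalse-band _ _)) (or-⇓≗ ff₁ ff₂)
  tt-cond (S3.j-or c₁⇓ c₂⇓) =
    let (tt₁ , ff₁) = tt-cond c₁⇓
        (tt₂ , ff₂) = tt-cond c₂⇓
    in ⇓≗-resp (λ _ → sym (is-btrue-bor _ _)) (or-⇓≗ tt₁ tt₂) ,
       ⇓≗-resp (λ _ → sym (is-bfalse-bor _ _)) (and-⇓≗ ff₁ ff₂)
  tt-cond (S3.j-not c⇓) =
    let (tt , ff) = tt-cond c⇓
    in ⇓≗-resp (λ _ → sym (is-btrue-bneg _)) ff , ⇓≗-resp (λ _ → sym (is-bfalse-bneg _)) tt

theorem3 : (Name : Set) (_≟N_ : DecidableEquality Name)
           (K : Set) (_≟K_ : DecidableEquality K) →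
           let open SQL Name _≟N_ K _≟K_ in
           (fresh : ℕ → List Name) → FreshSupply fresh →
           (D : Database) (Γ : Ctx) (Q : Query) (τ : Schema) (S : Env → Rel) →
           Eval 3VL D Γ Q τ S →
           Σ (Env → Rel) (λ S' →
             Eval 2VL D Γ (Translation.ttQ fresh Q) τ S' ×
             (∀ η → EnvFor Γ η → S η ↭ S' η))
theorem3 Name _≟N_ K _≟K_ fresh fresh-supply D Γ Q τ S Q⇓ =
  let (S' , Q⇓' , S'≗S) = Correctness.tt-query Name _≟N_ K _≟K_ fresh fresh-supply D Q⇓
  in S' , Q⇓' , λ η _ → ↭-reflexive (sym (S'≗S η))
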